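{- Let $\mathbf s$ be an epistandard word with directive word $\Delta=x_1x_2x_3\cdots$ ($x_i\in\mathcal A$), and let $\mathbf t$ be an episturmian word directed by a spinned version of $\Delta$. Then, for a non-negative integer $n$, $\mathbf t$ begins with $Pal(x_1\cdots x_n)$ if and only if $\mathbf t$ has a directive word of the form $x_1\cdots x_n\breve x_{n+1}\breve x_{n+2}\cdots$ (a spinned version of $\Delta$) whose prefix $x_1\cdots x_n$ is entirely $L$-spinned.
   Context: $\mathcal A$ finite alphabet. $Pal$: $Pal(\varepsilon)=\varepsilon$, and $Pal(wx)$ is the shortest palindrome having $Pal(w)x$ as a prefix. An epistandard word is an infinite word $\mathbf s=\lim_n Pal(x_1\cdots x_n)$ for an infinite word $\Delta=x_1x_2\cdots$ over $\mathcal A$, called its directive word. For $a\in\mathcal{A}$, $L_a,R_a$ are the morphisms with $L_a(a)=R_a(a)=a$, $L_a(b)=ab$, $R_a(b)=ba$ ($b\ne a$). Spinned words are words over $\mathcal A\cup\bar{\mathcal A}$, $\bar{\mathcal A}=\{\bar x:x\in\mathcal A\}$ (unbarred letters have spin $L$, barred spin $R$); a spinned version of $x_1x_2\cdots$ is $\breve x_1\breve x_2\cdots$ with $\breve x_i\in\{x_i,\bar x_i\}$. $\mu_a=L_a$, $\mu_{\bar a}=R_a$. Episturmian: infinite word with set of factors closed under reversal and at most one right special factor of each length. A spinned infinite word $\breve x_1\breve x_2\cdots$ directs $\mathbf t$ if there are recurrent infinite words $\mathbf t^{(n)}$ with $\mathbf t^{(0)}=\mathbf t$ and $\mathbf t^{(n-1)}=\mu_{\breve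 x_n}(\mathbf t^{(n)})$ for $n\ge1$. -}

module Defs where

open import Data.Nat using (ℕ; zero; suc; _+_; _≤_; _<_; _≥_)
open import Data.Fin using (Fin; toℕ; _≟_)
open import Data.List using (List; []; _∷_; _++_; _∷ʳ_; length; reverse; lookup; map; upTo; concatMap)
open import Data.Product using (Σ; ∃; ∃-syntax; _×_; _,_; proj₁; proj₂)
open import Data.Bool using (if_then_else_)
open import Relation.Nullary using (¬_; does)
open import Relation.Binary.PropositionalEquality using (_≡_)

-- The finite alphabet 𝒜 is (up to renaming) Fin k.
Letter : ℕ → Set
Letter k = Fin k

Word : ℕ → Set
Word k = List (Fin k)

InfWord : ℕ → Set
InfWord k = ℕ → Fin k

-- prefix x_1 ⋯ x_n of an infinite word x_1 x_2 ⋯ (0-indexed: x_{i+1} = Δ i)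
prefixω : {k : ℕ} → ℕ → InfWord k → Word k
prefixω n Δ = map Δ (upTo n)

IsPalindrome : {k : ℕ} → Word k → Set
IsPalindrome p = reverse p ≡ p

IsPrefixOf : {k : ℕ} → Word k → Word k → Set
IsPrefixOf u q = ∃[ z ] (u ++ z ≡ q)

ShortestPalWithPrefix : {k : ℕ} → Word k → Word k → Set
ShortestPalWithPrefix {k} u q =
  IsPalindrome q × IsPrefixOf u q ×
  ((r : Word k) → IsPalindrome r → IsPrefixOf u r → length q ≤ length r)

data PalOf {k : ℕ} : Word k → Word k → Set where
  pal-ε    : PalOf [] []
  pal-snoc : {w p q : Word k} {x : Fin k} →
             PalOf w p → ShortestPalWithPrefix (p ∷ʳ x) q → PalOf (w ∷ʳ x) q

BeginsWith : {k : ℕ} → InfWord k → Word k → Set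
BeginsWith t p = (i : Fin (length p)) → t (toℕ i) ≡ lookup p i

BeginsWithPal : {k : ℕ} → InfWord k → Word k → Set
BeginsWithPal t w = ∃[ p ] (PalOf w p × BeginsWith t p)

-- s is epistandard with directive word Δ : s = lim Pal(x_1⋯x_n)
-- (Pal(x_1⋯x_n) strictly grows, so this pins down the limit)
IsEpistandardWithDirective : {k : ℕ} → InfWord k → InfWord k → Set
IsEpistandardWithDirective s Δ =
  (n : ℕ) → ∀ p → PalOf (prefixω n Δ) p → BeginsWith s p

OccursAt : {k : ℕ} → InfWord k → Word k → ℕ → Set
OccursAt t w i = (j : Fin (length w)) → t (i + toℕ j) ≡ lookup w j

IsFactor : {k : ℕ} → InfWord k → Word k → Set
IsFactor t w = ∃[ i ] OccursAt t w i

IsRightSpecial : {k : ℕ} → InfWord k → Word k → Set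
IsRightSpecial t w = ∃[ a ] ∃[ b ] (¬ a ≡ b × IsFactor t (w ∷ʳ a) × IsFactor t (w ∷ʳ b))

IsEpisturmian : {k : ℕ} → InfWord k → Set
IsEpisturmian {k} t =
  ((w : Word k) → IsFactor t w → IsFactor t (reverse w)) ×
  ((u v : Word k) → length u ≡ length v →
     IsRightSpecial t u → IsRightSpecial t v → u ≡ v)

IsRecurrent : {k : ℕ} → InfWord k → Set
IsRecurrent {k} t = (w : Word k) → IsFactor t w → (m : ℕ) → ∃[ i ] (i ≥ m × OccursAt t w i)

data Spin : Set where
  L R : Spin

SpinnedLetter : ℕ → Set
SpinnedLetter k = Fin k × Spin

SpinnedInfWord : ℕ → Set
SpinnedInfWord k = ℕ → SpinnedLetter k

IsSpinnedVersionOf : {k : ℕ} → SpinnedInfWord k → InfWord k → Set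
IsSpinnedVersionOf D Δ = (i : ℕ) → proj₁ (D i) ≡ Δ i

-- μ_a = L_a, μ_{ā} = R_a, as maps on letters
μ : {k : ℕ} → SpinnedLetter k → Fin k → Word k
μ (a , L) b = if does (b ≟ a) then a ∷ [] else a ∷ b ∷ []
μ (a , R) b = if does (b ≟ a) then a ∷ [] else b ∷ a ∷ []

IsImage : {k : ℕ} → (Fin k → Word k) → InfWord k → InfWord k → Set
IsImage f u w = (n : ℕ) → BeginsWith w (concatMap f (prefixω n u))

Directs : {k : ℕ} → SpinnedInfWord k → InfWord k → Set
Directs {k} D t =
  Σ (ℕ → InfWord k) λ T →
    ((i : ℕ) → T 0 i ≡ t i) ×
    ((n : ℕ) → IsRecurrent (T n)) ×
    ((n : ℕ) → IsImage (μ (D n)) (T (suc n)) (T n))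

-- Justin's formula Pal(a w) = L_a(Pal w) a, derived from the definition of Pal by shortest palindromic
-- extensions, combines with the conjugation L_a(x) a = a R_a(x): an image L_a(u) begins with Pal(a w)
-- exactly when u begins with Pal(w). Iterating this along a directive chain whose first n spins are L
-- gives the "if" direction. Conversely, if t begins with Pal(x₁ ⋯ xₙ) it begins with x₁; when the first
-- spin is R, t = R_{x₁}(t′) where t′ also begins with x₁, and deleting this x₁ from the following words
-- of the chain (respinning their steps) turns the first step into L_{x₁}. The decoded word then begins
-- with Pal(x₂ ⋯ xₙ), and induction respins the whole prefix.

module Submission where

open import Defs
open import Data.Bool using (Bool; true; false; not; _∧_; if_then_else_)
open import Data.Bool.Properties using (∧-conicalˡ; ∧-conicalʳ)
open import Data.Empty using (⊥-elim)
open import Data.Fin as Fin using (Fin; toℕ; _≟_)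
open import Data.List using (List; []; _∷_; _++_; _∷ʳ_; length; reverse; map; applyUpTo; concatMap; take; drop; initLast; _∷ʳ′_)
open import Data.List.Properties
  using (++-assoc; ++-identityʳ; ++-cancelʳ; concatMap-++; length-++; length-reverse; length-take; reverse-++;
         reverse-involutive; reverse-injective; unfold-reverse; take++drop≡id; ∷-injective; ∷-injectiveˡ; ∷-injectiveʳ;
         ∷ʳ-injective; ∷ʳ-injectiveˡ; ∷ʳ-++)
open import Data.Nat using (ℕ; zero; suc; pred; _+_; _≤_; _<_; z≤n; s≤s)
open import Data.Nat.Properties
  using (+-comm; +-suc; ≤-antisym; ≤-trans; ≤-reflexive; +-cancelˡ-≤; +-cancelʳ-≤; +-cancelˡ-≡; +-mono-≤; +-monoʳ-≤;
         +-monoˡ-≤; m≤m+n; m≤n+m; m+n≮n; m≤n⇒m⊓n≡m; _≤?_; ≰⇒>; module ≤-Reasoning)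
open import Data.Nat.Tactic.RingSolver using (solve-∀)
open import Data.Product using (Σ; ∃-syntax; _×_; _,_; proj₁; proj₂)
open import Data.Unit using (⊤; tt)
open import Function using (_∘_)
open import Function.Bundles using (_⇔_; mk⇔; module Equivalence)
open import Relation.Binary.PropositionalEquality
open import Relation.Nullary using (Dec; does; yes; no)

module _ {A : Set} where

  ++-injective-≡length : (xs xs′ ys ys′ : List A) → length xs ≡ length xs′ →
                         xs ++ ys ≡ xs′ ++ ys′ → xs ≡ xs′ × ys ≡ ys′
  ++-injective-≡length []       []         ys ys′ _   eq = refl , eq
  ++-injective-≡length (x ∷ xs) (x′ ∷ xs′) ys ys′ len eq
    with refl , eq′ ← ∷-injective eq
    with refl , ys≡ys′ ← ++-injective-≡length xs xs′ ys ys′ (cong pred len) eq′ = refl , ys≡ys′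

  ∷ʳ≢[] : ∀ xs (x : A) → xs ∷ʳ x ≢ []
  ∷ʳ≢[] []      _ ()
  ∷ʳ≢[] (_ ∷ _) _ ()

  length-∷ʳ : ∀ xs (x : A) → length (xs ∷ʳ x) ≡ suc (length xs)
  length-∷ʳ xs x = trans (length-++ xs) (+-comm (length xs) 1)

  shorter-suffix : (xs ys xs′ ys′ : List A) → xs ++ ys ≡ xs′ ++ ys′ →
                   length ys′ ≤ length ys → ∃[ m ] (m ++ ys′ ≡ ys)
  shorter-suffix []       ys xs′       ys′ eq _  = xs′ , sym eq
  shorter-suffix (x ∷ xs) ys []        ys′ refl le = ⊥-elim (m+n≮n (length xs) (length ys)
    (subst (_≤ length ys) (cong suc (length-++ xs)) le))
  shorter-suffix (x ∷ xs) ys (_ ∷ xs′) ys′ eq le = shorter-suffix xs ys xs′ ys′ (proj₂ (∷-injective eq)) le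

IsSuffixOf : {k : ℕ} → Word k → Word k → Set
IsSuffixOf s w = ∃[ y ] (y ++ s ≡ w)

module _ {k : ℕ} where

  palindrome-wrap : {y s u : Word k} → y ++ s ≡ u → IsPalindrome s → IsPalindrome (u ++ reverse y)
  palindrome-wrap {y} {s} refl s-pal = begin
    reverse ((y ++ s) ++ reverse y)             ≡⟨ reverse-++ (y ++ s) (reverse y) ⟩
    reverse (reverse y) ++ reverse (y ++ s)     ≡⟨ cong₂ _++_ (reverse-involutive y) (reverse-++ y s) ⟩
    y ++ reverse s ++ reverse y                 ≡⟨ cong (λ v → y ++ v ++ reverse y) s-pal ⟩
    y ++ s ++ reverse y                         ≡⟨ ++-assoc y s (reverse y) ⟨
    (y ++ s) ++ reverse y                       ∎
    where open ≡-Reasoning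

  palindromic-suffix-head : {Y S w r : Word k} {b x : Fin k} → IsPalindrome S → Y ++ S ≡ w ∷ʳ x → S ≡ b ∷ r → b ≡ x
  palindromic-suffix-head {Y} {S} {w} {r} {b} {x} S-pal eq refl = ∷-injectiveˡ (begin
    b ∷ r ++ reverse Y        ≡⟨ cong (_++ reverse Y) S-pal ⟨
    reverse S ++ reverse Y    ≡⟨ reverse-++ Y S ⟨
    reverse (Y ++ S)          ≡⟨ cong reverse eq ⟩
    reverse (w ∷ʳ x)          ≡⟨ reverse-++ w (x ∷ []) ⟩
    x ∷ reverse w             ∎)
    where open ≡-Reasoning

  palindrome-split : {r u z : Word k} → IsPalindrome r → u ++ z ≡ r → length z ≤ length u →
                     ∃[ s ] (reverse z ++ s ≡ u × IsPalindrome s)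
  palindrome-split {r} {u} {z} r-pal refl |z|≤|u| = s , u≡z̃s , s-pal
    where
      y s : Word k
      y = take (length z) u
      s = drop (length z) u
      reversed : reverse z ++ reverse u ≡ y ++ (s ++ z)
      reversed = begin
        reverse z ++ reverse u  ≡⟨ reverse-++ u z ⟨
        reverse (u ++ z)        ≡⟨ r-pal ⟩
        u ++ z                  ≡⟨ cong (_++ z) (take++drop≡id (length z) u) ⟨
        (y ++ s) ++ z           ≡⟨ ++-assoc y s z ⟩
        y ++ (s ++ z)           ∎
        where open ≡-Reasoning
      halves : reverse z ≡ y × reverse u ≡ s ++ z
      halves = ++-injective-≡length (reverse z) y (reverse u) (s ++ z)
                 (trans (length-reverse z) (sym (trans (length-take (length z) u) (m≤n⇒m⊓n≡m |z|≤|u|))))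
                 reversed
      u≡z̃s : reverse z ++ s ≡ u
      u≡z̃s = trans (cong (_++ s) (proj₁ halves)) (take++drop≡id (length z) u)
      s-pal : IsPalindrome s
      s-pal = ++-cancelʳ z (reverse s) s (begin
        reverse s ++ z                       ≡⟨ cong (reverse s ++_) (reverse-involutive z) ⟨
        reverse s ++ reverse (reverse z)     ≡⟨ reverse-++ (reverse z) s ⟨
        reverse (reverse z ++ s)             ≡⟨ cong reverse u≡z̃s ⟩
        reverse u                            ≡⟨ proj₂ halves ⟩
        s ++ z                               ∎)
        where open ≡-Reasoning

  shortestPal-overhang : {u q z : Word k} → ShortestPalWithPrefix u q → u ++ z ≡ q → length z ≤ length u
  shortestPal-overhang {u} {q} {z} (_ , _ , minimal) refl = +-cancelˡ-≤ (length u) _ _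
    (subst₂ _≤_ (length-++ u) (trans (length-++ u) (cong (length u +_) (length-reverse u)))
      (minimal (u ++ reverse u) (palindrome-wrap {y = u} {s = []} (++-identityʳ u) refl) (reverse u , refl)))

  record ClosureSplit (u q : Word k) : Set where
    field
      y s       : Word k
      ys≡u      : y ++ s ≡ u
      uỹ≡q      : u ++ reverse y ≡ q
      s-longest : ∀ {s′} → IsSuffixOf s′ u → IsPalindrome s′ → length s′ ≤ length s

  shortestPal-split : {u q : Word k} → ShortestPalWithPrefix u q → ClosureSplit u q
  shortestPal-split {u} sp@(q-pal , (z , refl) , minimal)
    with s , z̃s≡u , _ ← palindrome-split {u = u} {z = z} q-pal refl (shortestPal-overhang sp refl)
    = record { y = reverse z ; s = s ; ys≡u = z̃s≡u
             ; uỹ≡q = cong (u ++_) (reverse-involutive z) ; s-longest = longest }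
    where
      longest : ∀ {s′} → IsSuffixOf s′ u → IsPalindrome s′ → length s′ ≤ length s
      longest {s′} (y′ , y′s′≡u) s′-pal = +-cancelˡ-≤ (length z) _ _ (begin
        length z + length s′   ≤⟨ +-monoˡ-≤ (length s′) |z|≤|y′| ⟩
        length y′ + length s′  ≡⟨ trans (cong length (trans z̃s≡u (sym y′s′≡u))) (length-++ y′) ⟨
        length (reverse z ++ s) ≡⟨ trans (length-++ (reverse z)) (cong (_+ length s) (length-reverse z)) ⟩
        length z + length s    ∎)
        where
          open ≤-Reasoning
          |z|≤|y′| : length z ≤ length y′
          |z|≤|y′| = +-cancelˡ-≤ (length u) _ _ (subst₂ _≤_ (length-++ u)
            (trans (length-++ u) (cong (length u +_) (length-reverse y′)))
            (minimal (u ++ reverse y′) (palindrome-wrap y′s′≡u s′-pal) (reverse y′ , refl)))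

  shortestPal-unique : {u q q′ : Word k} → ShortestPalWithPrefix u q → ShortestPalWithPrefix u q′ → q ≡ q′
  shortestPal-unique {u} {q} {q′} sp@(q-pal , q-prefix , minimal) sp′@(q′-pal , q′-prefix , minimal′) = begin
    q                   ≡⟨ C.uỹ≡q ⟨
    u ++ reverse C.y    ≡⟨ cong (λ v → u ++ reverse v) y≡y′ ⟩
    u ++ reverse C′.y   ≡⟨ C′.uỹ≡q ⟩
    q′                  ∎
    where
      open ≡-Reasoning
      module C  = ClosureSplit (shortestPal-split sp)
      module C′ = ClosureSplit (shortestPal-split sp′)
      |uỹ| : ∀ v → length (u ++ reverse v) ≡ length u + length v
      |uỹ| v = trans (length-++ u) (cong (length u +_) (length-reverse v))
      |y|≡|y′| : length C.y ≡ length C′.y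
      |y|≡|y′| = +-cancelˡ-≡ (length u) _ _ (trans (sym (|uỹ| C.y)) (trans (cong length C.uỹ≡q)
        (trans (≤-antisym (minimal q′ q′-pal q′-prefix) (minimal′ q q-pal q-prefix))
               (trans (cong length (sym C′.uỹ≡q)) (|uỹ| C′.y)))))
      y≡y′ : C.y ≡ C′.y
      y≡y′ = proj₁ (++-injective-≡length C.y C′.y C.s C′.s |y|≡|y′| (trans C.ys≡u (sym C′.ys≡u)))

L[_] R[_] : {k : ℕ} → Fin k → Word k → Word k
L[ a ] = concatMap (μ (a , L))
R[ a ] = concatMap (μ (a , R))

module Morphisms {k : ℕ} (a : Fin k) where

  μL-≡ : ∀ {b} → b ≡ a → μ (a , L) b ≡ a ∷ []
  μL-≡ {b} b≡a with b ≟ a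
  ... | yes _   = refl
  ... | no  b≢a = ⊥-elim (b≢a b≡a)

  μL-≢ : ∀ {b} → b ≢ a → μ (a , L) b ≡ a ∷ b ∷ []
  μL-≢ {b} b≢a with b ≟ a
  ... | yes b≡a = ⊥-elim (b≢a b≡a)
  ... | no  _   = refl

  μR-≡ : ∀ {b} → b ≡ a → μ (a , R) b ≡ a ∷ []
  μR-≡ {b} b≡a with b ≟ a
  ... | yes _   = refl
  ... | no  b≢a = ⊥-elim (b≢a b≡a)

  μR-≢ : ∀ {b} → b ≢ a → μ (a , R) b ≡ b ∷ a ∷ []
  μR-≢ {b} b≢a with b ≟ a
  ... | yes b≡a = ⊥-elim (b≢a b≡a)
  ... | no  _   = refl

  μL-head : ∀ b → ∃[ r ] (μ (a , L) b ≡ a ∷ r)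
  μL-head b with b ≟ a
  ... | yes _ = [] , refl
  ... | no  _ = b ∷ [] , refl

  μR-head : ∀ b → ∃[ r ] (μ (a , R) b ≡ b ∷ r)
  μR-head b with b ≟ a
  ... | yes refl = [] , refl
  ... | no  _    = a ∷ [] , refl

  μL∷ʳ≡∷μR : ∀ b → μ (a , L) b ∷ʳ a ≡ a ∷ μ (a , R) b
  μL∷ʳ≡∷μR b with b ≟ a
  ... | yes _ = refl
  ... | no  _ = refl

  reverse-μL : ∀ b → reverse (μ (a , L) b) ≡ μ (a , R) b
  reverse-μL b with b ≟ a
  ... | yes _ = refl
  ... | no  _ = refl

  L∷ʳ≡∷R : ∀ y → L[ a ] y ∷ʳ a ≡ a ∷ R[ a ] y
  L∷ʳ≡∷R []      = refl
  L∷ʳ≡∷R (c ∷ y) = begin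
    (μ (a , L) c ++ L[ a ] y) ∷ʳ a    ≡⟨ ++-assoc (μ (a , L) c) (L[ a ] y) (a ∷ []) ⟩
    μ (a , L) c ++ (L[ a ] y ∷ʳ a)    ≡⟨ cong (μ (a , L) c ++_) (L∷ʳ≡∷R y) ⟩
    μ (a , L) c ++ (a ∷ R[ a ] y)     ≡⟨ ++-assoc (μ (a , L) c) (a ∷ []) (R[ a ] y) ⟨
    (μ (a , L) c ∷ʳ a) ++ R[ a ] y    ≡⟨ cong (_++ R[ a ] y) (μL∷ʳ≡∷μR c) ⟩
    a ∷ μ (a , R) c ++ R[ a ] y       ∎
    where open ≡-Reasoning

  reverse-L : ∀ y → reverse (L[ a ] y) ≡ R[ a ] (reverse y)
  reverse-L []      = refl
  reverse-L (c ∷ y) = begin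
    reverse (μ (a , L) c ++ L[ a ] y)              ≡⟨ reverse-++ (μ (a , L) c) (L[ a ] y) ⟩
    reverse (L[ a ] y) ++ reverse (μ (a , L) c)    ≡⟨ cong₂ _++_ (reverse-L y) (reverse-μL c) ⟩
    R[ a ] (reverse y) ++ μ (a , R) c              ≡⟨ cong (R[ a ] (reverse y) ++_) (++-identityʳ _) ⟨
    R[ a ] (reverse y) ++ R[ a ] (c ∷ [])          ≡⟨ concatMap-++ _ (reverse y) (c ∷ []) ⟨
    R[ a ] (reverse y ∷ʳ c)                        ≡⟨ cong R[ a ] (unfold-reverse c y) ⟨
    R[ a ] (reverse (c ∷ y))                       ∎
    where open ≡-Reasoning

  reverse-L∷ʳ : ∀ y → reverse (L[ a ] y ∷ʳ a) ≡ L[ a ] (reverse y) ∷ʳ a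
  reverse-L∷ʳ y = begin
    reverse (L[ a ] y ∷ʳ a)      ≡⟨ reverse-++ (L[ a ] y) (a ∷ []) ⟩
    a ∷ reverse (L[ a ] y)       ≡⟨ cong (a ∷_) (reverse-L y) ⟩
    a ∷ R[ a ] (reverse y)       ≡⟨ L∷ʳ≡∷R (reverse y) ⟨
    L[ a ] (reverse y) ∷ʳ a      ∎
    where open ≡-Reasoning

  ‖_‖ : Word k → ℕ
  ‖ y ‖ = length (L[ a ] y)

  ‖‖-++ : ∀ x y → ‖ x ++ y ‖ ≡ ‖ x ‖ + ‖ y ‖
  ‖‖-++ x y = trans (cong length (concatMap-++ _ x y)) (length-++ (L[ a ] x))

  length-R : ∀ y → length (R[ a ] y) ≡ ‖ y ‖
  length-R y = cong pred (trans (cong length (sym (L∷ʳ≡∷R y))) (length-∷ʳ (L[ a ] y) a))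

  ‖‖-reverse : ∀ y → ‖ reverse y ‖ ≡ ‖ y ‖
  ‖‖-reverse y = begin
    length (L[ a ] (reverse y))             ≡⟨ length-reverse (L[ a ] (reverse y)) ⟨
    length (reverse (L[ a ] (reverse y)))   ≡⟨ cong length (reverse-L (reverse y)) ⟩
    length (R[ a ] (reverse (reverse y)))   ≡⟨ cong (λ v → length (R[ a ] v)) (reverse-involutive y) ⟩
    length (R[ a ] y)                       ≡⟨ length-R y ⟩
    ‖ y ‖                                   ∎
    where open ≡-Reasoning

  L-head : ∀ c y → ∃[ r ] (L[ a ] (c ∷ y) ≡ a ∷ r)
  L-head c y = proj₁ (μL-head c) ++ L[ a ] y , cong (_++ L[ a ] y) (proj₂ (μL-head c))

  L-head-≡ : ∀ y {c r} → L[ a ] y ≡ c ∷ r → c ≡ a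
  L-head-≡ (d ∷ y) eq = sym (∷-injectiveˡ (trans (sym (proj₂ (L-head d y))) eq))

  L-injective : ∀ y y′ → L[ a ] y ≡ L[ a ] y′ → y ≡ y′
  L-injective []      []       _  = refl
  L-injective []      (c ∷ y′) eq with () ← trans eq (proj₂ (L-head c y′))
  L-injective (c ∷ y) []       eq with () ← trans (sym eq) (proj₂ (L-head c y))
  L-injective (c ∷ y) (c′ ∷ y′) eq with c ≟ a | c′ ≟ a
  ... | yes c≡a | yes c′≡a = cong₂ _∷_ (trans c≡a (sym c′≡a)) (L-injective y y′ (∷-injectiveʳ eq))
  ... | yes _   | no  c′≢a = ⊥-elim (c′≢a (L-head-≡ y (∷-injectiveʳ eq)))
  ... | no  c≢a | yes _    = ⊥-elim (c≢a (L-head-≡ y′ (∷-injectiveʳ (sym eq))))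
  ... | no  _   | no  _
    with c≡c′ , eq′ ← ∷-injective (∷-injectiveʳ eq) = cong₂ _∷_ c≡c′ (L-injective y y′ eq′)

  palindrome-L∷ʳ⁺ : ∀ {s} → IsPalindrome s → IsPalindrome (L[ a ] s ∷ʳ a)
  palindrome-L∷ʳ⁺ {s} s-pal = trans (reverse-L∷ʳ s) (cong (λ v → L[ a ] v ∷ʳ a) s-pal)

  palindrome-L∷ʳ⁻ : ∀ {s} → IsPalindrome (L[ a ] s ∷ʳ a) → IsPalindrome s
  palindrome-L∷ʳ⁻ {s} pal = sym (L-injective s (reverse s) (∷ʳ-injectiveˡ (L[ a ] s) (L[ a ] (reverse s)) (trans (sym pal) (reverse-L∷ʳ s))))

  L-∷ʳ : ∀ p x → L[ a ] (p ∷ʳ x) ≡ L[ a ] p ++ μ (a , L) x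
  L-∷ʳ p x = trans (concatMap-++ _ p (x ∷ [])) (cong (L[ a ] p ++_) (++-identityʳ _))

  L-∷ʳ-≢ : ∀ p {x} → x ≢ a → L[ a ] (p ∷ʳ x) ≡ (L[ a ] p ∷ʳ a) ∷ʳ x
  L-∷ʳ-≢ p {x} x≢a = begin
    L[ a ] (p ∷ʳ x)             ≡⟨ L-∷ʳ p x ⟩
    L[ a ] p ++ μ (a , L) x     ≡⟨ cong (L[ a ] p ++_) (μL-≢ x≢a) ⟩
    L[ a ] p ++ a ∷ x ∷ []      ≡⟨ ++-assoc (L[ a ] p) (a ∷ []) (x ∷ []) ⟨
    (L[ a ] p ∷ʳ a) ∷ʳ x        ∎
    where open ≡-Reasoning

  L-∷ʳ-≡ : ∀ p → L[ a ] (p ∷ʳ a) ≡ L[ a ] p ∷ʳ a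
  L-∷ʳ-≡ p = trans (L-∷ʳ p a) (cong (L[ a ] p ++_) (μL-≡ refl))

closure-length-overlap : ∀ {A B d U z S} → U ≡ z + S → U ≡ d + (A + B) → suc S ≤ (d + d) + B →
                         suc ((A + B) + A) ≤ U + z
closure-length-overlap {A} {B} {d} {U} {z} {S} U≡z+S U≡d+A+B S<2d+B = +-cancelʳ-≤ (suc S) _ _ (begin
  suc ((A + B) + A) + suc S                ≤⟨ +-monoʳ-≤ (suc ((A + B) + A)) S<2d+B ⟩
  suc ((A + B) + A) + ((d + d) + B)        ≡⟨ cong suc (regroup A B d) ⟩
  suc ((d + (A + B)) + (d + (A + B)))      ≡⟨ cong (λ n → suc (n + n)) U≡d+A+B ⟨
  suc (U + U)                              ≡⟨ cong (λ n → suc (U + n)) U≡z+S ⟩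
  suc (U + (z + S))                        ≡⟨ shift U z S ⟩
  (U + z) + suc S                          ∎)
  where
    open ≤-Reasoning
    regroup : ∀ A B d → ((A + B) + A) + ((d + d) + B) ≡ (d + (A + B)) + (d + (A + B))
    regroup = solve-∀
    shift : ∀ U z S → suc (U + (z + S)) ≡ (U + z) + suc S
    shift = solve-∀

closure-length-long : ∀ {A B d U z} → U ≡ d + (A + B) → U < z → suc ((A + B) + A) ≤ U + z
closure-length-long {A} {B} {d} {U} {z} U≡d+A+B U<z = begin
  suc ((A + B) + A)   ≤⟨ s≤s (+-mono-≤ A+B≤U (≤-trans (m≤m+n A B) A+B≤U)) ⟩
  suc (U + U)         ≡⟨ +-suc U U ⟨
  U + suc U           ≤⟨ +-monoʳ-≤ U U<z ⟩
  U + z               ∎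
  where
    open ≤-Reasoning
    A+B≤U : A + B ≤ U
    A+B≤U = subst (A + B ≤_) (sym U≡d+A+B) (m≤n+m (A + B) d)

module ClosureUnderL {k : ℕ} (a : Fin k) where
  open Morphisms a

  data SuffixOfL (v S : Word k) : Set where
    image : ∀ s → IsSuffixOf s v → S ≡ L[ a ] s → SuffixOfL v S
    split : ∀ c s → IsSuffixOf (c ∷ s) v → c ≢ a → S ≡ c ∷ L[ a ] s → SuffixOfL v S

  suffixOfL-∷ : ∀ {c v S} → SuffixOfL v S → SuffixOfL (c ∷ v) S
  suffixOfL-∷ {c} (image s (y , eq) S≡Ls)        = image s (c ∷ y , cong (c ∷_) eq) S≡Ls
  suffixOfL-∷ {c} (split c′ s (y , eq) c′≢a S≡) = split c′ s (c ∷ y , cong (c ∷_) eq) c′≢a S≡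

  suffix-of-L : ∀ v Y S → Y ++ S ≡ L[ a ] v → SuffixOfL v S
  suffix-of-L []      []      []      _  = image [] ([] , refl) refl
  suffix-of-L (c ∷ v) []      S       eq = image (c ∷ v) ([] , refl) eq
  suffix-of-L (c ∷ v) (_ ∷ Y) S       eq with c ≟ a
  suffix-of-L (c ∷ v) (_ ∷ Y)      S eq | yes _   = suffixOfL-∷ (suffix-of-L v Y S (∷-injectiveʳ eq))
  suffix-of-L (c ∷ v) (_ ∷ [])     S eq | no  c≢a = split c v ([] , refl) c≢a (∷-injectiveʳ eq)
  suffix-of-L (c ∷ v) (_ ∷ _ ∷ Y)  S eq | no  _   = suffixOfL-∷ (suffix-of-L v Y S (∷-injectiveʳ (∷-injectiveʳ eq)))

  palSuffix-L-≢ : ∀ p {x Y S} → x ≢ a → Y ++ S ≡ L[ a ] (p ∷ʳ x) → IsPalindrome S →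
                  ∃[ s ] (IsSuffixOf s (p ∷ʳ x) × IsPalindrome s × suc (length S) ≤ ‖ s ‖)
  palSuffix-L-≢ p {x} {Y} {[]} x≢a _ _ =
    x ∷ [] , (p , refl) , refl , subst (λ v → 1 ≤ length (v ++ [])) (sym (μL-≢ x≢a)) (s≤s z≤n)
  palSuffix-L-≢ p {x} {Y} {S@(_ ∷ _)} x≢a eq S-pal with suffix-of-L (p ∷ʳ x) Y S eq
  ... | image [] _ ()
  ... | image (d ∷ s) _ S≡Ls = ⊥-elim (x≢a (sym (palindromic-suffix-head S-pal
          (trans eq (L-∷ʳ-≢ p x≢a)) (trans S≡Ls (proj₂ (L-head d s))))))
  ... | split c s suffix c≢a S≡cLs =
    c ∷ s , suffix , palindrome-L∷ʳ⁻ (subst (λ v → IsPalindrome (v ∷ʳ a)) aS≡L (palindrome-wrap {y = a ∷ []} refl S-pal)) ,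
    ≤-reflexive (cong length aS≡L)
    where
      aS≡L : a ∷ S ≡ L[ a ] (c ∷ s)
      aS≡L = trans (cong (a ∷_) S≡cLs) (cong (_++ L[ a ] s) (sym (μL-≢ c≢a)))

  palSuffix-L-≡ : ∀ p {Y S} → Y ++ S ≡ L[ a ] (p ∷ʳ a) ∷ʳ a → IsPalindrome S →
                  ∃[ s ] (IsSuffixOf s (p ∷ʳ a) × IsPalindrome s × length S ≤ suc ‖ s ‖)
  palSuffix-L-≡ p {Y} {S} eq S-pal with initLast S
  ... | [] = [] , (p ∷ʳ a , ++-identityʳ _) , refl , z≤n
  ... | S₁ ∷ʳ′ l
    with Y++S₁≡ , refl ← ∷ʳ-injective (Y ++ S₁) (L[ a ] (p ∷ʳ a)) (trans (++-assoc Y S₁ (l ∷ [])) eq)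
    with suffix-of-L (p ∷ʳ a) Y S₁ Y++S₁≡
  ... | image s suffix S₁≡Ls =
    s , suffix , palindrome-L∷ʳ⁻ (subst (λ v → IsPalindrome (v ∷ʳ a)) S₁≡Ls S-pal) ,
    ≤-reflexive (trans (length-∷ʳ S₁ a) (cong (suc ∘ length) S₁≡Ls))
  ... | split c s _ c≢a S₁≡cLs = ⊥-elim (c≢a (palindromic-suffix-head {Y = Y} S-pal eq (cong (_∷ʳ a) S₁≡cLs)))

  -- The common core of the cases x ≢ a (d = 0) and x ≡ a (d = 1) of L-closure below.
  L-closure-minimal : {u q U : Word k} (d : ℕ) → ShortestPalWithPrefix u q → length U ≡ d + ‖ u ‖ →
    (∀ {Y S} → Y ++ S ≡ U → IsPalindrome S →
       ∃[ s ] (IsSuffixOf s u × IsPalindrome s × suc (length S) ≤ (d + d) + ‖ s ‖)) →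
    ∀ r → IsPalindrome r → IsPrefixOf U r → suc ‖ q ‖ ≤ length r
  L-closure-minimal {u} {q} {U} d sp |U|≡ palSuffix r r-pal (z , refl) =
    subst₂ (λ m n → suc m ≤ n) (sym ‖q‖≡) (sym (length-++ U)) bound
    where
      open ClosureSplit (shortestPal-split sp)
      ‖u‖≡ : ‖ u ‖ ≡ ‖ y ‖ + ‖ s ‖
      ‖u‖≡ = trans (cong ‖_‖ (sym ys≡u)) (‖‖-++ y s)
      ‖q‖≡ : ‖ q ‖ ≡ (‖ y ‖ + ‖ s ‖) + ‖ y ‖
      ‖q‖≡ = trans (cong ‖_‖ (sym uỹ≡q)) (trans (‖‖-++ u (reverse y)) (cong₂ _+_ ‖u‖≡ (‖‖-reverse y)))
      |U|≡′ : length U ≡ d + (‖ y ‖ + ‖ s ‖)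
      |U|≡′ = trans |U|≡ (cong (d +_) ‖u‖≡)
      s-heaviest : ∀ {s′} → IsSuffixOf s′ u → IsPalindrome s′ → ‖ s′ ‖ ≤ ‖ s ‖
      s-heaviest {s′} (y′ , y′s′≡u) s′-pal
        with m , ms′≡s ← shorter-suffix y s y′ s′ (trans ys≡u (sym y′s′≡u)) (s-longest (y′ , y′s′≡u) s′-pal)
        = subst (λ v → ‖ s′ ‖ ≤ ‖ v ‖) ms′≡s (subst (‖ s′ ‖ ≤_) (sym (‖‖-++ m s′)) (m≤n+m _ _))
      bound : suc ((‖ y ‖ + ‖ s ‖) + ‖ y ‖) ≤ length U + length z
      bound with length z ≤? length U
      ... | no |z|≰|U| = closure-length-long {A = ‖ y ‖} {B = ‖ s ‖} {d = d} |U|≡′ (≰⇒> |z|≰|U|)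
      ... | yes |z|≤|U|
        with S , z̃S≡U , S-pal ← palindrome-split {u = U} {z = z} r-pal refl |z|≤|U|
        with s′ , suffix , s′-pal , S<s′ ← palSuffix z̃S≡U S-pal
        = closure-length-overlap {A = ‖ y ‖} {B = ‖ s ‖} {d = d}
            (trans (cong length (sym z̃S≡U)) (trans (length-++ (reverse z)) (cong (_+ length S) (length-reverse z))))
            |U|≡′ (≤-trans S<s′ (+-monoʳ-≤ (d + d) (s-heaviest suffix s′-pal)))

  L-prefix : {p q : Word k} {x : Fin k} → IsPrefixOf (p ∷ʳ x) q → IsPrefixOf ((L[ a ] p ∷ʳ a) ∷ʳ x) (L[ a ] q ∷ʳ a)
  L-prefix {p} {x = x} (z , refl) with r , μR≡xr ← μR-head x = r ++ R[ a ] z , (begin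
    ((L[ a ] p ∷ʳ a) ∷ʳ x) ++ r ++ R[ a ] z    ≡⟨ ++-assoc (L[ a ] p ∷ʳ a) (x ∷ []) _ ⟩
    (L[ a ] p ∷ʳ a) ++ x ∷ r ++ R[ a ] z       ≡⟨ ++-assoc (L[ a ] p) (a ∷ []) _ ⟩
    L[ a ] p ++ a ∷ x ∷ r ++ R[ a ] z          ≡⟨ cong (λ v → L[ a ] p ++ a ∷ v ++ R[ a ] z) μR≡xr ⟨
    L[ a ] p ++ a ∷ R[ a ] (x ∷ z)             ≡⟨ cong (L[ a ] p ++_) (L∷ʳ≡∷R (x ∷ z)) ⟨
    L[ a ] p ++ (L[ a ] (x ∷ z) ∷ʳ a)          ≡⟨ ++-assoc (L[ a ] p) (L[ a ] (x ∷ z)) (a ∷ []) ⟨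
    (L[ a ] p ++ L[ a ] (x ∷ z)) ∷ʳ a          ≡⟨ cong (_∷ʳ a) (concatMap-++ _ p (x ∷ z)) ⟨
    L[ a ] (p ++ x ∷ z) ∷ʳ a                   ≡⟨ cong (λ v → L[ a ] v ∷ʳ a) (∷ʳ-++ p x z) ⟨
    L[ a ] ((p ∷ʳ x) ++ z) ∷ʳ a                ∎)
    where open ≡-Reasoning

  L-closure : {p q : Word k} {x : Fin k} → ShortestPalWithPrefix (p ∷ʳ x) q →
              ShortestPalWithPrefix ((L[ a ] p ∷ʳ a) ∷ʳ x) (L[ a ] q ∷ʳ a)
  L-closure {p} {q} {x} sp@(q-pal , q-prefix , _) =
    palindrome-L∷ʳ⁺ q-pal , L-prefix q-prefix ,
    λ r r-pal U-prefix → subst (_≤ length r) (sym (length-∷ʳ (L[ a ] q) a)) (minimal (x ≟ a) r r-pal U-prefix)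
    where
      U : Word k
      U = (L[ a ] p ∷ʳ a) ∷ʳ x
      minimal : Dec (x ≡ a) → ∀ r → IsPalindrome r → IsPrefixOf U r → suc ‖ q ‖ ≤ length r
      minimal (no x≢a) = L-closure-minimal 0 sp (cong length (sym (L-∷ʳ-≢ p x≢a)))
        (λ eq S-pal → palSuffix-L-≢ p x≢a (trans eq (sym (L-∷ʳ-≢ p x≢a))) S-pal)
      minimal (yes refl) = L-closure-minimal 1 sp
        (trans (cong length (cong (_∷ʳ a) (sym (L-∷ʳ-≡ p)))) (length-∷ʳ (L[ a ] (p ∷ʳ a)) a))
        (λ eq S-pal → let s , suffix , s-pal , S≤ = palSuffix-L-≡ p (trans eq (cong (_∷ʳ a) (sym (L-∷ʳ-≡ p)))) S-pal
                      in s , suffix , s-pal , s≤s S≤)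

tailω : {A : Set} → (ℕ → A) → ℕ → A
tailω w i = w (suc i)

Pal : {k : ℕ} → Word k → Word k
Pal []      = []
Pal (a ∷ w) = L[ a ] (Pal w) ∷ʳ a

module _ {k : ℕ} where

  PalOf-∷ : ∀ {w p} (a : Fin k) → PalOf w p → PalOf (a ∷ w) (L[ a ] p ∷ʳ a)
  PalOf-∷ a pal-ε = pal-snoc pal-ε (refl , ([] , refl) , λ r _ (z , a∷z≡r) → subst (λ v → 1 ≤ length v) a∷z≡r (s≤s z≤n))
  PalOf-∷ a (pal-snoc pal closure) = pal-snoc (PalOf-∷ a pal) (ClosureUnderL.L-closure a closure)

  PalOf-Pal : ∀ w → PalOf w (Pal {k} w)
  PalOf-Pal []      = pal-ε
  PalOf-Pal (a ∷ w) = PalOf-∷ a (PalOf-Pal w)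

  PalOf-functional : ∀ {w w′ p p′ : Word k} → w ≡ w′ → PalOf w p → PalOf w′ p′ → p ≡ p′
  PalOf-functional w≡w′ pal-ε pal-ε = refl
  PalOf-functional w≡w′ pal-ε (pal-snoc {w} {x = x} _ _) = ⊥-elim (∷ʳ≢[] w x (sym w≡w′))
  PalOf-functional w≡w′ (pal-snoc {w} {x = x} _ _) pal-ε = ⊥-elim (∷ʳ≢[] w x w≡w′)
  PalOf-functional w≡w′ (pal-snoc {w} {x = x} pal closure) (pal-snoc {w′} pal′ closure′)
    with w≡w′ , refl ← ∷ʳ-injective w w′ w≡w′
    = shortestPal-unique (subst (λ p → ShortestPalWithPrefix (p ∷ʳ x) _) (PalOf-functional w≡w′ pal pal′) closure) closure′

  dropω : ℕ → InfWord k → InfWord k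
  dropω m w i = w (m + i)

  takeω : ℕ → InfWord k → Word k
  takeω zero    u = []
  takeω (suc n) u = u 0 ∷ takeω n (tailω u)

  StartsWith : InfWord k → Word k → Set
  StartsWith w []       = ⊤
  StartsWith w (c ∷ cs) = w 0 ≡ c × StartsWith (tailω w) cs

  Image : (Fin k → Word k) → InfWord k → InfWord k → Set
  Image f u w = ∀ n → StartsWith w (concatMap f (takeω n u))

  takeω-suc : ∀ n u → takeω (suc n) u ≡ takeω n u ∷ʳ u n
  takeω-suc zero    u = refl
  takeω-suc (suc n) u = cong (u 0 ∷_) (takeω-suc n (tailω u))

  takeω-cong : ∀ {u u′} → u ≗ u′ → ∀ n → takeω n u ≡ takeω n u′
  takeω-cong eq zero    = refl
  takeω-cong eq (suc n) = cong₂ _∷_ (eq 0) (takeω-cong (eq ∘ suc) n)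

  prefixω≡takeω : ∀ n u → prefixω n u ≡ takeω n u
  prefixω≡takeω n u = map-applyUpTo n (λ i → i)
    where
      map-applyUpTo : ∀ n (g : ℕ → ℕ) → map u (applyUpTo g n) ≡ takeω n (u ∘ g)
      map-applyUpTo zero    g = refl
      map-applyUpTo (suc n) g = cong (u (g 0) ∷_) (map-applyUpTo n (g ∘ suc))

  StartsWith-cong : ∀ {w w′} → w ≗ w′ → ∀ xs → StartsWith w xs → StartsWith w′ xs
  StartsWith-cong eq []       _         = tt
  StartsWith-cong eq (c ∷ xs) (w0≡c , h) = trans (sym (eq 0)) w0≡c , StartsWith-cong (eq ∘ suc) xs h

  StartsWith-++⁻ : ∀ w xs ys → StartsWith w (xs ++ ys) → StartsWith w xs × StartsWith (dropω (length xs) w) ys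
  StartsWith-++⁻ w []       ys h          = tt , h
  StartsWith-++⁻ w (c ∷ xs) ys (w0≡c , h) with hxs , hys ← StartsWith-++⁻ (tailω w) xs ys h = (w0≡c , hxs) , hys

  StartsWith-++⁺ : ∀ w xs ys → StartsWith w xs → StartsWith (dropω (length xs) w) ys → StartsWith w (xs ++ ys)
  StartsWith-++⁺ w []       ys _          h = h
  StartsWith-++⁺ w (c ∷ xs) ys (w0≡c , h) h′ = w0≡c , StartsWith-++⁺ (tailω w) xs ys h h′

  BeginsWith⇔StartsWith : ∀ w xs → BeginsWith w xs ⇔ StartsWith w xs
  BeginsWith⇔StartsWith w xs = mk⇔ (to w xs) (from w xs)
    where
      to : ∀ w xs → BeginsWith w xs → StartsWith w xs
      to w []       h = tt
      to w (c ∷ xs) h = h Fin.zero , to (tailω w) xs (h ∘ Fin.suc)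
      from : ∀ w xs → StartsWith w xs → BeginsWith w xs
      from w (c ∷ xs) (w0≡c , h) Fin.zero    = w0≡c
      from w (c ∷ xs) (w0≡c , h) (Fin.suc i) = from (tailω w) xs h i

  IsImage⇔Image : ∀ f u w → IsImage f u w ⇔ Image f u w
  IsImage⇔Image f u w = mk⇔
    (λ h n → Equivalence.to (BeginsWith⇔StartsWith w _) (subst (BeginsWith w) (cong (concatMap f) (prefixω≡takeω n u)) (h n)))
    (λ h n → subst (BeginsWith w) (cong (concatMap f) (sym (prefixω≡takeω n u))) (Equivalence.from (BeginsWith⇔StartsWith w _) (h n)))

  Image-cong : ∀ f {u u′ w w′} → u ≗ u′ → w ≗ w′ → Image f u w → Image f u′ w′
  Image-cong f {w = w} u≗u′ w≗w′ h n =
    StartsWith-cong w≗w′ _ (subst (λ v → StartsWith w (concatMap f v)) (takeω-cong u≗u′ n) (h n))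

  Image-head : ∀ f {u w} → Image f u w → StartsWith w (f (u 0))
  Image-head f {u} {w} h = proj₁ (StartsWith-++⁻ w (f (u 0)) [] (h 1))

  Image-drop : ∀ f {u w} → Image f u w → Image f (tailω u) (dropω (length (f (u 0))) w)
  Image-drop f {u} {w} h n = proj₂ (StartsWith-++⁻ w (f (u 0)) _ (h (suc n)))

  IsRecurrent-cong : {w w′ : InfWord k} → w ≗ w′ → IsRecurrent w → IsRecurrent w′
  IsRecurrent-cong eq rec x (i , occ) m
    with i′ , i′≥m , occ′ ← rec x (i , λ j → trans (eq (i + toℕ j)) (occ j)) m
    = i′ , i′≥m , λ j → trans (sym (eq (i′ + toℕ j))) (occ′ j)

  IsRecurrent-tail : {w : InfWord k} → IsRecurrent w → IsRecurrent (tailω w)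
  IsRecurrent-tail rec x (i , occ) m with rec x (suc i , occ) (suc m)
  ... | suc i′ , s≤s i′≥m , occ′ = i′ , i′≥m , occ′

  module _ (c : Fin k) where
    open Morphisms c

    L-image-head : ∀ {u w} → Image (μ (c , L)) u w → w 0 ≡ c
    L-image-head {u} {w} h = proj₁ (subst (StartsWith w) (proj₂ (μL-head (u 0))) (Image-head _ h))

    R-image-head : ∀ {u w} → Image (μ (c , R)) u w → w 0 ≡ u 0
    R-image-head {u} {w} h = proj₁ (subst (StartsWith w) (proj₂ (μR-head (u 0))) (Image-head _ h))

    L-image-tail : ∀ {u w} → Image (μ (c , L)) u w → Image (μ (c , R)) u (tailω w)
    L-image-tail {u} {w} h n with r , μL≡cr ← μL-head (u n) =
      proj₂ (proj₁ (StartsWith-++⁻ w (c ∷ R[ c ] (takeω n u)) r (subst (StartsWith w) image≡ (h (suc n)))))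
      where
        open ≡-Reasoning
        image≡ : L[ c ] (takeω (suc n) u) ≡ (c ∷ R[ c ] (takeω n u)) ++ r
        image≡ = begin
          L[ c ] (takeω (suc n) u)               ≡⟨ cong L[ c ] (takeω-suc n u) ⟩
          L[ c ] (takeω n u ∷ʳ u n)              ≡⟨ L-∷ʳ (takeω n u) (u n) ⟩
          L[ c ] (takeω n u) ++ μ (c , L) (u n)  ≡⟨ cong (L[ c ] (takeω n u) ++_) μL≡cr ⟩
          L[ c ] (takeω n u) ++ c ∷ r            ≡⟨ ++-assoc (L[ c ] (takeω n u)) (c ∷ []) r ⟨
          (L[ c ] (takeω n u) ∷ʳ c) ++ r         ≡⟨ cong (_++ r) (L∷ʳ≡∷R (takeω n u)) ⟩
          (c ∷ R[ c ] (takeω n u)) ++ r          ∎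

    R-image-tail-≡ : ∀ {u w} → Image (μ (c , R)) u w → u 0 ≡ c → Image (μ (c , R)) (tailω u) (tailω w)
    R-image-tail-≡ {u} {w} h u0≡c n =
      proj₂ (subst (StartsWith w) (cong (_++ R[ c ] (takeω n (tailω u))) (μR-≡ u0≡c)) (h (suc n)))

    R-image-tail-≢ : ∀ {u w} → Image (μ (c , R)) u w → u 0 ≢ c → Image (μ (c , L)) (tailω u) (tailω w)
    R-image-tail-≢ {u} {w} h u0≢c n = proj₁ (StartsWith-++⁻ (tailω w) (L[ c ] t) (c ∷ [])
      (subst (StartsWith (tailω w)) (sym (L∷ʳ≡∷R t))
        (proj₂ (subst (StartsWith w) (cong (_++ R[ c ] t) (μR-≢ u0≢c)) (h (suc n))))))
      where t = takeω n (tailω u)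

    R-image-as-L : ∀ {u w} → Image (μ (c , R)) u w → u 0 ≡ c → Image (μ (c , L)) (tailω u) w
    R-image-as-L {u} {w} h u0≡c n = proj₁ (StartsWith-++⁻ w (L[ c ] t) (c ∷ [])
      (subst (StartsWith w) (trans (cong (_++ R[ c ] t) (μR-≡ u0≡c)) (sym (L∷ʳ≡∷R t))) (h (suc n))))
      where t = takeω n (tailω u)

    R-image-startsWith⁺ : ∀ {z w} → Image (μ (c , R)) z w → ∀ p → StartsWith z p → StartsWith w (R[ c ] p)
    R-image-startsWith⁺ h []      _          = tt
    R-image-startsWith⁺ {z} {w} h (b ∷ p) (z0≡b , hz) =
      subst (λ x → StartsWith w (μ (c , R) x ++ R[ c ] p)) z0≡b
        (StartsWith-++⁺ w (μ (c , R) (z 0)) (R[ c ] p) (Image-head _ h) (R-image-startsWith⁺ (Image-drop _ h) p hz))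

    R-image-startsWith⁻ : ∀ {z w} → Image (μ (c , R)) z w → ∀ p → StartsWith w (R[ c ] p) → StartsWith z p
    R-image-startsWith⁻ h []      _  = tt
    R-image-startsWith⁻ {z} {w} h (b ∷ p) hw =
      z0≡b , R-image-startsWith⁻ (Image-drop _ h) p
        (subst (λ x → StartsWith (dropω (length (μ (c , R) x)) w) (R[ c ] p)) (sym z0≡b)
          (proj₂ (StartsWith-++⁻ w (μ (c , R) b) (R[ c ] p) hw)))
      where
        z0≡b : z 0 ≡ b
        z0≡b = trans (sym (R-image-head h)) (proj₁ (subst (StartsWith w) (cong (_++ R[ c ] p) (proj₂ (μR-head b))) hw))

    L-image-startsWith⁺ : ∀ {z w} → Image (μ (c , L)) z w → ∀ p → StartsWith z p → StartsWith w (L[ c ] p ∷ʳ c)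
    L-image-startsWith⁺ {w = w} h p hz =
      subst (StartsWith w) (sym (L∷ʳ≡∷R p)) (L-image-head h , R-image-startsWith⁺ (L-image-tail h) p hz)

    L-image-startsWith⁻ : ∀ {z w} → Image (μ (c , L)) z w → ∀ p → StartsWith w (L[ c ] p ∷ʳ c) → StartsWith z p
    L-image-startsWith⁻ {w = w} h p hw =
      R-image-startsWith⁻ (L-image-tail h) p (proj₂ (subst (StartsWith w) (L∷ʳ≡∷R p) hw))

_∷ω_ : {A : Set} → A → (ℕ → A) → ℕ → A
(x ∷ω f) zero    = x
(x ∷ω f) (suc n) = f n

record DirectsWith {k : ℕ} (Δ : InfWord k) (σ : ℕ → Spin) (t : InfWord k) : Set where
  field
    T         : ℕ → InfWord k
    T0≗t      : T 0 ≗ t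
    recurrent : ∀ n → IsRecurrent (T n)
    image     : ∀ n → Image (μ (Δ n , σ n)) (T (suc n)) (T n)

module _ {k : ℕ} {Δ : InfWord k} where

  directsWith⁺ : ∀ {D t} → IsSpinnedVersionOf D Δ → Directs D t → DirectsWith Δ (proj₂ ∘ D) t
  directsWith⁺ {D} D≈Δ (T , T0≗t , recurrent , image) = record
    { T = T ; T0≗t = T0≗t ; recurrent = recurrent
    ; image = λ n → subst (λ c → Image (μ (c , proj₂ (D n))) (T (suc n)) (T n)) (D≈Δ n)
                      (Equivalence.to (IsImage⇔Image _ _ _) (image n)) }

  directsWith⁻ : ∀ {σ t} → DirectsWith Δ σ t → Directs (λ i → Δ i , σ i) t
  directsWith⁻ d = T , T0≗t , recurrent , λ n → Equivalence.from (IsImage⇔Image _ _ _) (image n)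
    where open DirectsWith d

  directsWith-tail : ∀ {σ t} (d : DirectsWith Δ σ t) → DirectsWith (tailω Δ) (tailω σ) (DirectsWith.T d 1)
  directsWith-tail d = record { T = T ∘ suc ; T0≗t = λ _ → refl ; recurrent = recurrent ∘ suc ; image = image ∘ suc }
    where open DirectsWith d

  directsWith-∷ : ∀ {s σ u t} → IsRecurrent t → Image (μ (Δ 0 , s)) u t → DirectsWith (tailω Δ) σ u →
                  DirectsWith Δ (s ∷ω σ) t
  directsWith-∷ {t = t} t-rec t-image d = record
    { T = t ∷ω T ; T0≗t = λ _ → refl
    ; recurrent = λ { zero → t-rec ; (suc n) → recurrent n }
    ; image = λ { zero → Image-cong _ (sym ∘ T0≗t) (λ _ → refl) t-image ; (suc n) → image n } }
    where open DirectsWith d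

-- While the leading a of T 0 has not been absorbed by a step (a , L), it is the first letter of every
-- T j; deleting it from all of them keeps the chain valid once letter a is respun to ā and every
-- other letter to L.
module Respin {k : ℕ} (a : Fin k) (Δ : InfWord k) (σ : ℕ → Spin) (T : ℕ → InfWord k)
              (image : ∀ n → Image (μ (Δ n , σ n)) (T (suc n)) (T n)) (T0-starts : T 0 0 ≡ a) where

  absorbs : Fin k → Spin → Bool
  absorbs c L = does (c ≟ a)
  absorbs c R = false

  active : ℕ → Bool
  active zero    = true
  active (suc j) = active j ∧ not (absorbs (Δ j) (σ j))

  respun : Fin k → Spin
  respun c = if does (c ≟ a) then R else L

  σ′ : ℕ → Spin
  σ′ j = if active j then respun (Δ j) else σ j

  T′ : ℕ → InfWord k
  T′ j = if active j then tailω (T j) else T j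

  starts-next : ∀ c s {u v} → Image (μ (c , s)) u v → v 0 ≡ a → not (absorbs c s) ≡ true → u 0 ≡ a
  starts-next c L h v0≡a kept with c ≟ a
  ... | no c≢a = ⊥-elim (c≢a (trans (sym (L-image-head c h)) v0≡a))
  starts-next c L h v0≡a () | yes _
  starts-next c R h v0≡a _ = trans (sym (R-image-head c h)) v0≡a

  active-starts : ∀ j → active j ≡ true → T j 0 ≡ a
  active-starts zero    _   = T0-starts
  active-starts (suc j) act = starts-next (Δ j) (σ j) (image j)
    (active-starts j (∧-conicalˡ _ _ act)) (∧-conicalʳ (active j) _ act)

  drop-head : ∀ c s {u v} → v 0 ≡ a → Image (μ (c , s)) u v →
              Image (μ (c , respun c)) (if not (absorbs c s) then tailω u else u) (tailω v)
  drop-head c L v0≡a h with c ≟ a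
  ... | yes refl = L-image-tail a h
  ... | no  c≢a  = ⊥-elim (c≢a (trans (sym (L-image-head c h)) v0≡a))
  drop-head c R {u} v0≡a h with c ≟ a
  ... | yes refl = R-image-tail-≡ a h u0≡a
    where u0≡a = trans (sym (R-image-head a h)) v0≡a
  ... | no  c≢a  = R-image-tail-≢ c h (λ u0≡c → c≢a (trans (sym u0≡c) (trans (sym (R-image-head c h)) v0≡a)))

  image-step : ∀ b {c s u v} → (b ≡ true → v 0 ≡ a) → Image (μ (c , s)) u v →
               Image (μ (c , (if b then respun c else s))) (if b ∧ not (absorbs c s) then tailω u else u)
                     (if b then tailω v else v)
  image-step false _      h = h
  image-step true {c} {s} starts h = drop-head c s (starts refl) h

  image′ : ∀ j → Image (μ (Δ j , σ′ j)) (T′ (suc j)) (T′ j)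
  image′ j = image-step (active j) (active-starts j) (image j)

  recurrent′ : (∀ j → IsRecurrent (T j)) → ∀ j → IsRecurrent (T′ j)
  recurrent′ rec j with active j
  ... | true  = IsRecurrent-tail {w = T j} (rec j)
  ... | false = rec j

module _ {k : ℕ} where

  respin-head : ∀ {Δ σ t} → DirectsWith {k} Δ σ t → t 0 ≡ Δ 0 → ∃[ σ′ ] (σ′ 0 ≡ L × DirectsWith Δ σ′ t)
  respin-head {Δ} {σ} {t} d t0≡a with σ 0 in σ0≡
  ... | L = σ , σ0≡ , d
  ... | R = L ∷ω σ′ , refl , record
    { T = T 0 ∷ω T′ ; T0≗t = T0≗t
    ; recurrent = λ { zero → recurrent 0 ; (suc j) → recurrent′ (recurrent ∘ suc) j }
    ; image = λ { zero → R-image-as-L (Δ 0) image₀ T1-starts ; (suc j) → image′ j } }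
    where
      open DirectsWith d
      image₀ : Image (μ (Δ 0 , R)) (T 1) (T 0)
      image₀ = subst (λ s → Image (μ (Δ 0 , s)) (T 1) (T 0)) σ0≡ (image 0)
      T1-starts : T 1 0 ≡ Δ 0
      T1-starts = trans (sym (R-image-head (Δ 0) image₀)) (trans (T0≗t 0) t0≡a)
      open Respin (Δ 0) (tailω Δ) (tailω σ) (T ∘ suc) (image ∘ suc) T1-starts

  respin-prefix : ∀ n {Δ σ t} → DirectsWith {k} Δ σ t → StartsWith t (Pal (takeω n Δ)) →
                  ∃[ σ′ ] ((∀ i → i < n → σ′ i ≡ L) × DirectsWith Δ σ′ t)
  respin-prefix zero    {σ = σ} d _ = σ , (λ _ ()) , d
  respin-prefix (suc n) {Δ} {t = t} d h =
    let σ₁ , σ₁0≡L , d₁ = respin-head d (proj₁ (subst (StartsWith t) (Morphisms.L∷ʳ≡∷R (Δ 0) p) h))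
        open DirectsWith d₁
        image₀ : Image (μ (Δ 0 , L)) (T 1) (T 0)
        image₀ = subst (λ s → Image (μ (Δ 0 , s)) (T 1) (T 0)) σ₁0≡L (image 0)
        σ₂ , σ₂-prefix , d₂ = respin-prefix n (directsWith-tail d₁)
                                (L-image-startsWith⁻ (Δ 0) image₀ p (StartsWith-cong (sym ∘ T0≗t) _ h))
    in L ∷ω σ₂ , (λ { zero _ → refl ; (suc i) (s≤s i<n) → σ₂-prefix i i<n }) ,
       directsWith-∷ (IsRecurrent-cong T0≗t (recurrent 0)) (Image-cong _ (λ _ → refl) T0≗t image₀) d₂
    where
      p : Word k
      p = Pal (takeω n (tailω Δ))

  directed-startsWith-Pal : ∀ n {Δ σ t} → DirectsWith {k} Δ σ t → (∀ i → i < n → σ i ≡ L) →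
                            StartsWith t (Pal (takeω n Δ))
  directed-startsWith-Pal zero    _ _ = tt
  directed-startsWith-Pal (suc n) {Δ} d σ-prefix =
    StartsWith-cong T0≗t _ (L-image-startsWith⁺ (Δ 0) image₀ _
      (directed-startsWith-Pal n (directsWith-tail d) (λ i i<n → σ-prefix (suc i) (s≤s i<n))))
    where
      open DirectsWith d
      image₀ : Image (μ (Δ 0 , L)) (T 1) (T 0)
      image₀ = subst (λ s → Image (μ (Δ 0 , s)) (T 1) (T 0)) (σ-prefix 0 (s≤s z≤n)) (image 0)

  BeginsWithPal⇔StartsWith-Pal : ∀ t w → BeginsWithPal {k} t w ⇔ StartsWith t (Pal w)
  BeginsWithPal⇔StartsWith-Pal t w = mk⇔
    (λ (p , pal , h) → subst (StartsWith t) (PalOf-functional refl pal (PalOf-Pal w)) (Equivalence.to (BeginsWith⇔StartsWith t p) h))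
    (λ h → Pal w , PalOf-Pal w , Equivalence.from (BeginsWith⇔StartsWith t (Pal w)) h)

-- The equivalence holds for every word directed by a spinned version of Δ: the hypotheses on s and t are unused.
proposition4p9 : (k : ℕ) (Δ s : InfWord k) → IsEpistandardWithDirective s Δ →
    (t : InfWord k) → IsEpisturmian t →
    (D : SpinnedInfWord k) → IsSpinnedVersionOf D Δ → Directs D t →
    (n : ℕ) →
    BeginsWithPal t (prefixω n Δ)
      ⇔ Σ (SpinnedInfWord k) (λ D′ → IsSpinnedVersionOf D′ Δ ×
           ((i : ℕ) → i < n → proj₂ (D′ i) ≡ L) × Directs D′ t)
proposition4p9 k Δ _ _ t _ D D≈Δ D→t n = mk⇔
  (λ h → let σ′ , σ′-prefix , d′ = respin-prefix n (directsWith⁺ {D = D} D≈Δ D→t) (to-Pal h)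
         in (λ i → Δ i , σ′ i) , (λ _ → refl) , σ′-prefix , directsWith⁻ d′)
  (λ (D′ , D′≈Δ , D′-prefix , D′→t) → from-Pal (directed-startsWith-Pal n (directsWith⁺ {D = D′} D′≈Δ D′→t) D′-prefix))
  where
    Pal-prefix⇔ : BeginsWithPal t (prefixω n Δ) ⇔ StartsWith t (Pal (takeω n Δ))
    Pal-prefix⇔ = subst (λ w → BeginsWithPal t (prefixω n Δ) ⇔ StartsWith t (Pal w)) (prefixω≡takeω n Δ)
                    (BeginsWithPal⇔StartsWith-Pal t (prefixω n Δ))
    open Equivalence Pal-prefix⇔ renaming (to to to-Pal; from to from-Pal)
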